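{- Let $\mathcal{A}_1$ be the set of $\mathbf{q}\in((\mathbb{Z}/8\mathbb{Z})^*)^4$ such that either $q_i+q_j\in\{0,4\}$ for at least one pair $(i,j)\in\{0,1\}\times\{2,3\}$, or $(q_0+q_1,q_2+q_3)\in\{(0,0),(2,0),(2,6),(0,6),(6,0),(6,2),(0,2)\}$ (all in $\mathbb{Z}/8\mathbb{Z}$). Let $\mathcal{A}_2$ be the set of $\mathbf{q}\in((\mathbb{Z}/8\mathbb{Z})^*)^4$ for which there exist $i,j,k,l$ with $\{(i,j),(k,l)\}=\{(0,1),(2,3)\}$ and $v\in(\mathbb{Z}/8\mathbb{Z})^*$ such that either ($q_i+q_j=0$ and $(q_k+v)(q_l+v)=0$) or ($q_i+q_j=2v$ and $(q_k+v)(q_l+v)=0$) in $\mathbb{Z}/8\mathbb{Z}$. Suppose $a_0,a_1,a_2,a_3\in\mathbb{N}$ are square-free and non-zero with $\gcd(a_0,a_1,a_2,a_3)=1$, and let $\langle a_0,a_1,a_2,a_3\rangle_2$ equal $1$ if the quadric $a_0x_0^2+a_1x_1^2+a_2x_2^2+a_3x_3^2=0$ has a $\mathbb{Q}_2$-point (nonzero solution in $\mathbb{Q}_2^4$) and $0$ otherwise. Then: (a) if $2\nmid a_0a_1a_2a_3$, then $\langle a_0,a_1,a_2,a_3\rangle_2=1$ if and only if $(a_0,a_1,a_2,a_3)$ reduces modulo $8$ to an element of $\mathcal{A}_1$; (b) if $2\mid a_i,a_j$ for distinct $i,j\in\{0,1,2,3\}$ and $2\nmid a_ka_l$ for the distinct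 $k,l\in\{0,1,2,3\}\setminus\{i,j\}$, then $\langle a_0,a_1,a_2,a_3\rangle_2=1$ if and only if $(a_i/2,a_j/2,a_k,a_l)$ reduces modulo $8$ to an element of $\mathcal{A}_2$. -}

module Defs where

open import Data.Nat using (ℕ; zero; suc; _+_; _*_; _∸_; _^_; _<_; _%_; _/_)
open import Data.Nat.Divisibility using (_∣_)
open import Data.Nat.GCD using (gcd)
open import Data.Fin using (Fin)
open import Data.Fin.Patterns using (0F; 1F; 2F; 3F)
open import Data.Product using (Σ; ∃; _×_; _,_)
open import Data.Sum using (_⊎_)
open import Data.List using (List; []; _∷_)
open import Data.List.Membership.Propositional using (_∈_)
open import Relation.Binary.PropositionalEquality using (_≡_; _≢_)
open import Relation.Nullary using (¬_)
open import Function.Bundles using (_⇔_)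

SquareFree : ℕ → Set
SquareFree n = ∀ d → d * d ∣ n → d ≡ 1

-- 2-adic integers ℤ₂ as the inverse limit of ℤ/2ⁿℤ:
-- a compatible family of residues  digit n ∈ {0,…,2ⁿ-1}  with
-- digit (n+1) ≡ digit n (mod 2ⁿ).

record ℤ₂ : Set where
  field
    digit : ℕ → ℕ
    bound : ∀ n → digit n < 2 ^ n
    coh   : ∀ n → digit (suc n) ≡ digit n ⊎ digit (suc n) ≡ digit n + 2 ^ n
open ℤ₂ public

NonZero₂ : ℤ₂ → Set
NonZero₂ z = Σ ℕ λ n → digit z n ≢ 0

-- 2-adic numbers ℚ₂: an element is  z / 2^k  with z ∈ ℤ₂ (every element of
-- ℚ₂ has this form).
record ℚ₂ : Set where
  constructor _/2^_
  field
    num : ℤ₂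
    den : ℕ
open ℚ₂ public

NonZeroℚ₂ : ℚ₂ → Set
NonZeroℚ₂ x = NonZero₂ (num x)

-- With K = k₀+k₁+k₂+k₃ and xᵢ = zᵢ/2^kᵢ, the equation is equivalent (after
-- multiplying by the unit-free factor 2^(2K)) to the ℤ₂-equation
--   Σ aᵢ 2^(2(K-kᵢ)) zᵢ² = 0,
-- which holds in ℤ₂ = lim ℤ/2ⁿ iff it holds modulo 2ⁿ for every n.
QuadZero : (Fin 4 → ℕ) → (Fin 4 → ℚ₂) → Set
QuadZero a x = ∀ n → 2 ^ n ∣ term 0F n + term 1F n + term 2F n + term 3F n
  where
  K : ℕ
  K = den (x 0F) + den (x 1F) + den (x 2F) + den (x 3F)
  term : Fin 4 → ℕ → ℕ
  term i n = a i * 2 ^ (2 * (K ∸ den (x i))) * (digit (num (x i)) n ^ 2)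

HasQ₂Point : (Fin 4 → ℕ) → Set
HasQ₂Point a = Σ (Fin 4 → ℚ₂) λ x → (Σ (Fin 4) λ i → NonZeroℚ₂ (x i)) × QuadZero a x

-- Residues modulo 8 (represented by ℕ in {0,…,7}); units are odd residues.

Unit₈ : ℕ → Set
Unit₈ q = (q < 8) × (q % 2 ≡ 1)

red₈ : (Fin 4 → ℕ) → Fin 4 → ℕ
red₈ a i = a i % 8

_⊕_ : ℕ → ℕ → ℕ
x ⊕ y = (x + y) % 8

A₁pairs : List (ℕ × ℕ)
A₁pairs = (0 , 0) ∷ (2 , 0) ∷ (2 , 6) ∷ (0 , 6) ∷ (6 , 0) ∷ (6 , 2) ∷ (0 , 2) ∷ []

𝒜₁ : (Fin 4 → ℕ) → Set
𝒜₁ q = (∀ i → Unit₈ (q i)) ×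
  ( (Σ (Fin 4) λ i → Σ (Fin 4) λ j → (i ≡ 0F ⊎ i ≡ 1F) × (j ≡ 2F ⊎ j ≡ 3F) ×
       ((q i ⊕ q j) ≡ 0 ⊎ (q i ⊕ q j) ≡ 4))
  ⊎ ((q 0F ⊕ q 1F) , (q 2F ⊕ q 3F)) ∈ A₁pairs )

PairSplit : Fin 4 → Fin 4 → Fin 4 → Fin 4 → Set
PairSplit i j k l =
    ((i ≡ 0F × j ≡ 1F) × (k ≡ 2F × l ≡ 3F))
  ⊎ ((i ≡ 2F × j ≡ 3F) × (k ≡ 0F × l ≡ 1F))

𝒜₂ : (Fin 4 → ℕ) → Set
𝒜₂ q = (∀ i → Unit₈ (q i)) ×
  (Σ (Fin 4) λ i → Σ (Fin 4) λ j → Σ (Fin 4) λ k → Σ (Fin 4) λ l →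
   PairSplit i j k l × Σ ℕ λ v → Unit₈ v ×
   ( ((q i ⊕ q j) ≡ 0 × ((q k + v) * (q l + v)) % 8 ≡ 0)
   ⊎ ((q i ⊕ q j) ≡ (2 * v) % 8 × ((q k + v) * (q l + v)) % 8 ≡ 0)))

tup : ℕ → ℕ → ℕ → ℕ → Fin 4 → ℕ
tup x₀ x₁ x₂ x₃ 0F = x₀
tup x₀ x₁ x₂ x₃ 1F = x₁
tup x₀ x₁ x₂ x₃ 2F = x₂
tup x₀ x₁ x₂ x₃ 3F = x₃

{-# OPTIONS --safe #-}
-- A nonzero ℚ₂-point rescales to integer vectors yₙ with 2ⁿ ∣ Σ aᵢyᵢ², one coordinate of which is
-- not divisible by a fixed power of 2.  So there is no point as soon as every zero of the form modulo
-- 16 has all coordinates even: halving such a zero divides the form by 4, and iterating this descent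
-- makes every coordinate of yₙ as divisible by 2 as we like.  Whether this happens is read off the
-- possible pairs (aᵢyᵢ² mod 16, yᵢ mod 2), which only depend on the 2-adic valuation of aᵢ and on the
-- odd part of aᵢ modulo 8.  Conversely, if a₀ = 2ᵉu with u odd and (1, c₁, c₂, c₃) is a zero modulo
-- 2^(3+e), Hensel's lemma for 2-adic square roots lifts it to an exact zero.  A finite computation over
-- the unit residues shows that the descent applies exactly when 𝒜₁ (resp. 𝒜₂) fails, and that a
-- liftable zero exists when it holds; in case (b) a permutation of the coordinates first moves the
-- even coefficients to the front.
module Submission where

open import Defs
open import Data.Nat using (ℕ; _*_; _/_)
open import Data.Nat.Divisibility using (_∣_)
open import Data.Nat.GCD using (gcd)
open import Data.Fin using (Fin)
open import Data.Fin.Patterns using (0F; 1F; 2F; 3F)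
open import Data.Product using (_×_)
open import Relation.Binary.PropositionalEquality using (_≡_; _≢_)
open import Relation.Nullary using (¬_)
open import Function.Bundles using (_⇔_)

open import Data.Bool using (if_then_else_)
open import Data.Empty using (⊥-elim)
import Data.Fin.Properties as Fin
open import Data.Fin.Permutation using (Permutation′; permutation; _⟨$⟩ʳ_; _⟨$⟩ˡ_; inverseʳ; flip)
open import Data.List using (List; []; _∷_)
open import Data.List.Membership.Propositional using (_∈_)
open import Data.List.Relation.Unary.All as All using (All)
open import Data.Nat using (zero; suc; _+_; _∸_; _^_; _≤_; _<_; _%_; z≤n; s≤s; NonZero; _≟_; _<?_)
open import Data.Nat.Properties
  using (*-comm; *-assoc; *-identityˡ; *-identityʳ; +-identityʳ; m^n≢0; ^-distribˡ-+-*; ^-*-assoc; m∸n+n≡m; m∸n≤m;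
         m≤n+m; m≤m+n; n≤1+n; +-monoˡ-≤; +-monoˡ-<; <-≤-trans; anyUpTo?; allUpTo?; +-0-commutativeMonoid)
open import Data.Nat.DivMod
  using (m≡m%n+[m/n]*n; m%n%n≡m%n; %-distribˡ-+; %-distribˡ-*; [m+kn]%n≡m%n; m%n<n; m<n⇒m%n≡m; %-remove-+ʳ;
         m∣n⇒o%n%m≡o%m; m%[n*o]/o≡m/o%n; m*[n/m]≡n)
open import Data.Nat.Divisibility
  using (divides; _∣?_; ∣-trans; n∣m*n; m∣m*n; ∣m+n∣m⇒∣n; *-cancelˡ-∣; *-monoʳ-∣; ∣m⇒∣m*n; ∣n⇒∣m*n; 1∣_;
         m%n≡0⇒n∣m; n∣m⇒m%n≡0)
open import Data.Nat.Tactic.RingSolver using (solve-∀)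
open import Data.Product using (Σ; ∃; _,_; proj₁; proj₂)
open import Data.Product.Properties using (≡-dec)
open import Data.Sum using (_⊎_; inj₁; inj₂)
import Data.Sum as Sum
open import Function using (_∘_)
open import Function.Bundles using (mk⇔; Equivalence)
open import Function.Properties.Equivalence using () renaming (trans to ⇔-trans)
open import Relation.Binary.PropositionalEquality using (refl; sym; trans; cong; cong₂; subst; subst₂; module ≡-Reasoning)
open import Relation.Nullary using (Dec; does; contradiction; ¬?; _×-dec_; _⊎-dec_; _→-dec_)
open import Relation.Nullary.Decidable using (yes; no; from-yes; map′)

open import Algebra.Properties.CommutativeMonoid.Sum +-0-commutativeMonoid using (sum; sum-permute)
open import Data.List.Membership.DecPropositional (≡-dec _≟_ _≟_) using (_∈?_)

Odd : ℕ → Set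
Odd n = ∃ λ j → n ≡ 1 + 2 * j

%2≡1⇒Odd : ∀ {n} → n % 2 ≡ 1 → Odd n
%2≡1⇒Odd {n} n-odd = n / 2 , trans (m≡m%n+[m/n]*n n 2) (cong₂ _+_ n-odd (*-comm (n / 2) 2))

∤2⇒%2≡1 : ∀ {x} → ¬ 2 ∣ x → x % 2 ≡ 1
∤2⇒%2≡1 {x} 2∤x with x % 2 in eq | m%n<n x 2
... | 0 | _ = contradiction (m%n≡0⇒n∣m x 2 eq) 2∤x
... | 1 | _ = refl
... | suc (suc _) | s≤s (s≤s ())

∤-*ˡ : ∀ {d} m n → ¬ d ∣ m * n → ¬ d ∣ m
∤-*ˡ m n d∤mn d∣m = d∤mn (∣m⇒∣m*n n d∣m)

∤-*ʳ : ∀ {d} m n → ¬ d ∣ m * n → ¬ d ∣ n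
∤-*ʳ m n d∤mn d∣n = d∤mn (∣n⇒∣m*n m d∣n)

odd-coefficients : ∀ (a : Fin 4 → ℕ) → ¬ 2 ∣ a 0F * a 1F * a 2F * a 3F → ∀ p → a p % 2 ≡ 1
odd-coefficients a 2∤a₀a₁a₂a₃ p = ∤2⇒%2≡1 (2∤ p)
  where
  2∤a₀a₁a₂ : ¬ 2 ∣ a 0F * a 1F * a 2F
  2∤a₀a₁a₂ = ∤-*ˡ (a 0F * a 1F * a 2F) (a 3F) 2∤a₀a₁a₂a₃
  2∤a₀a₁ : ¬ 2 ∣ a 0F * a 1F
  2∤a₀a₁ = ∤-*ˡ (a 0F * a 1F) (a 2F) 2∤a₀a₁a₂
  2∤ : ∀ p → ¬ 2 ∣ a p
  2∤ 0F = ∤-*ˡ (a 0F) (a 1F) 2∤a₀a₁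
  2∤ 1F = ∤-*ʳ (a 0F) (a 1F) 2∤a₀a₁
  2∤ 2F = ∤-*ʳ (a 0F * a 1F) (a 2F) 2∤a₀a₁a₂
  2∤ 3F = ∤-*ʳ (a 0F * a 1F * a 2F) (a 3F) 2∤a₀a₁a₂a₃

half-odd : ∀ x → SquareFree x → 2 ∣ x → (x / 2) % 2 ≡ 1
half-odd x square-free 2∣x = ∤2⇒%2≡1 2∤x/2
  where
  2∤x/2 : ¬ 2 ∣ x / 2
  2∤x/2 (divides w x/2≡w*2) = contradiction (square-free 2 (divides w x≡w*4)) λ ()
    where
    open ≡-Reasoning
    x≡w*4 : x ≡ w * (2 * 2)
    x≡w*4 = begin
      x              ≡⟨ m*[n/m]≡n 2∣x ⟨
      2 * (x / 2)    ≡⟨ cong (2 *_) x/2≡w*2 ⟩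
      2 * (w * 2)    ≡⟨ regroup w ⟩
      w * (2 * 2)    ∎
      where
      regroup : ∀ w → 2 * (w * 2) ≡ w * (2 * 2)
      regroup = solve-∀

Σ₄ : (Fin 4 → ℕ) → ℕ
Σ₄ f = f 0F + f 1F + f 2F + f 3F

Σ₄-cong : ∀ {f g} → (∀ p → f p ≡ g p) → Σ₄ f ≡ Σ₄ g
Σ₄-cong f≗g = cong₂ _+_ (cong₂ _+_ (cong₂ _+_ (f≗g 0F) (f≗g 1F)) (f≗g 2F)) (f≗g 3F)

form : (Fin 4 → ℕ) → (Fin 4 → ℕ) → ℕ
form a y = Σ₄ λ p → a p * y p ^ 2

form-congʳ : ∀ a {y y′} → (∀ p → y p ≡ y′ p) → form a y ≡ form a y′
form-congʳ a y≗y′ = Σ₄-cong λ p → cong (λ t → a p * t ^ 2) (y≗y′ p)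

-- x ^ 2 unfolds to x * (x * 1), the form in which the ring solver is given squares.
square-* : ∀ x y → (x * y) ^ 2 ≡ x ^ 2 * y ^ 2
square-* = unfolded
  where
  unfolded : ∀ x y → x * y * (x * y * 1) ≡ x * (x * 1) * (y * (y * 1))
  unfolded = solve-∀

form-double : ∀ a y → form a (λ p → 2 * y p) ≡ 4 * form a y
form-double a y = trans (Σ₄-cong λ p → trans (cong (a p *_) (square-* 2 (y p))) (swap (a p) (y p ^ 2)))
                        (distrib 4 (a 0F * y 0F ^ 2) (a 1F * y 1F ^ 2) (a 2F * y 2F ^ 2) (a 3F * y 3F ^ 2))
  where
  swap : ∀ A Y → A * (4 * Y) ≡ 4 * (A * Y)
  swap = solve-∀
  distrib : ∀ k A B C D → k * A + k * B + k * C + k * D ≡ k * (A + B + C + D)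
  distrib = solve-∀

form-tup : ∀ a s c₁ c₂ c₃ →
           form a (tup s c₁ c₂ c₃) ≡ a 0F * s ^ 2 + (a 1F * c₁ ^ 2 + a 2F * c₂ ^ 2 + a 3F * c₃ ^ 2)
form-tup a s c₁ c₂ c₃ = reassociate (a 0F * s ^ 2) (a 1F * c₁ ^ 2) (a 2F * c₂ ^ 2) (a 3F * c₃ ^ 2)
  where
  reassociate : ∀ A B C D → A + B + C + D ≡ A + (B + C + D)
  reassociate = solve-∀

tup-η : ∀ (q : Fin 4 → ℕ) i → tup (q 0F) (q 1F) (q 2F) (q 3F) i ≡ q i
tup-η q 0F = refl
tup-η q 1F = refl
tup-η q 2F = refl
tup-η q 3F = refl

-- Congruences modulo powers of two

infixl 7 _%2^_
_%2^_ : ℕ → ℕ → ℕ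
x %2^ n = _%_ x (2 ^ n) {{m^n≢0 2 n}}

2^-mono-∣ : ∀ {m n} → m ≤ n → 2 ^ m ∣ 2 ^ n
2^-mono-∣ {m} {n} m≤n = divides (2 ^ (n ∸ m)) (trans (cong (2 ^_) (sym (m∸n+n≡m m≤n))) (^-distribˡ-+-* 2 (n ∸ m) m))

-- Opaque, so that unification can read the compared numbers off a congruence.
opaque
  infix 4 _≡_mod2^_
  _≡_mod2^_ : ℕ → ℕ → ℕ → Set
  x ≡ y mod2^ n = x %2^ n ≡ y %2^ n

module _ {n : ℕ} where
  private instance
    2ⁿ≢0 : NonZero (2 ^ n)
    2ⁿ≢0 = m^n≢0 2 n

  opaque
    unfolding _≡_mod2^_

    mod2^⇒%2^≡ : ∀ {x y} → x ≡ y mod2^ n → x %2^ n ≡ y %2^ n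
    mod2^⇒%2^≡ x≡y = x≡y

    ≡⇒mod2^ : ∀ {x y} → x ≡ y → x ≡ y mod2^ n
    ≡⇒mod2^ refl = refl

    mod2^-refl : ∀ x → x ≡ x mod2^ n
    mod2^-refl x = refl

    mod2^-sym : ∀ {x y} → x ≡ y mod2^ n → y ≡ x mod2^ n
    mod2^-sym = sym

    mod2^-trans : ∀ {x y z} → x ≡ y mod2^ n → y ≡ z mod2^ n → x ≡ z mod2^ n
    mod2^-trans = trans

    %2^-mod : ∀ x → x %2^ n ≡ x mod2^ n
    %2^-mod x = m%n%n≡m%n x (2 ^ n)

    +-*2^-mod : ∀ x k → x + k * 2 ^ n ≡ x mod2^ n
    +-*2^-mod x k = [m+kn]%n≡m%n x k (2 ^ n)

    +-cong-mod : ∀ {x x′ y y′} → x ≡ x′ mod2^ n → y ≡ y′ mod2^ n → x + y ≡ x′ + y′ mod2^ n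
    +-cong-mod {x} {x′} {y} {y′} x≡x′ y≡y′ = begin
      (x + y) % 2 ^ n                      ≡⟨ %-distribˡ-+ x y (2 ^ n) ⟩
      (x % 2 ^ n + y % 2 ^ n) % 2 ^ n      ≡⟨ cong₂ (λ s t → (s + t) % 2 ^ n) x≡x′ y≡y′ ⟩
      (x′ % 2 ^ n + y′ % 2 ^ n) % 2 ^ n    ≡⟨ %-distribˡ-+ x′ y′ (2 ^ n) ⟨
      (x′ + y′) % 2 ^ n                    ∎
      where open ≡-Reasoning

    *-cong-mod : ∀ {x x′ y y′} → x ≡ x′ mod2^ n → y ≡ y′ mod2^ n → x * y ≡ x′ * y′ mod2^ n
    *-cong-mod {x} {x′} {y} {y′} x≡x′ y≡y′ = begin
      (x * y) % 2 ^ n                      ≡⟨ %-distribˡ-* x y (2 ^ n) ⟩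
      (x % 2 ^ n * (y % 2 ^ n)) % 2 ^ n    ≡⟨ cong₂ (λ s t → (s * t) % 2 ^ n) x≡x′ y≡y′ ⟩
      (x′ % 2 ^ n * (y′ % 2 ^ n)) % 2 ^ n  ≡⟨ %-distribˡ-* x′ y′ (2 ^ n) ⟨
      (x′ * y′) % 2 ^ n                    ∎
      where open ≡-Reasoning

    ∣-resp-mod : ∀ {x y} → x ≡ y mod2^ n → 2 ^ n ∣ x → 2 ^ n ∣ y
    ∣-resp-mod {x} {y} x≡y 2ⁿ∣x = m%n≡0⇒n∣m y (2 ^ n) (trans (sym x≡y) (n∣m⇒m%n≡0 x (2 ^ n) 2ⁿ∣x))

opaque
  unfolding _≡_mod2^_

  mod2^-weaken : ∀ {m n x y} → m ≤ n → x ≡ y mod2^ n → x ≡ y mod2^ m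
  mod2^-weaken {m} {n} {x} {y} m≤n x≡y = begin
    x % 2 ^ m             ≡⟨ m∣n⇒o%n%m≡o%m (2 ^ m) (2 ^ n) x (2^-mono-∣ m≤n) ⟨
    x % 2 ^ n % 2 ^ m     ≡⟨ cong (_% 2 ^ m) x≡y ⟩
    y % 2 ^ n % 2 ^ m     ≡⟨ m∣n⇒o%n%m≡o%m (2 ^ m) (2 ^ n) y (2^-mono-∣ m≤n) ⟩
    y % 2 ^ m             ∎
    where
    open ≡-Reasoning
    instance
      2ᵐ≢0 : NonZero (2 ^ m)
      2ᵐ≢0 = m^n≢0 2 m
      2ⁿ≢0 : NonZero (2 ^ n)
      2ⁿ≢0 = m^n≢0 2 n

Σ₄-cong-mod : ∀ {n f g} → (∀ p → f p ≡ g p mod2^ n) → Σ₄ f ≡ Σ₄ g mod2^ n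
Σ₄-cong-mod f≡g = +-cong-mod (+-cong-mod (+-cong-mod (f≡g 0F) (f≡g 1F)) (f≡g 2F)) (f≡g 3F)

^-cong-mod : ∀ {n x y} k → x ≡ y mod2^ n → x ^ k ≡ y ^ k mod2^ n
^-cong-mod zero x≡y = mod2^-refl 1
^-cong-mod (suc k) x≡y = *-cong-mod x≡y (^-cong-mod k x≡y)

form-congˡ-mod : ∀ {n a a′} y → (∀ p → a p ≡ a′ p mod2^ n) → form a y ≡ form a′ y mod2^ n
form-congˡ-mod y a≡a′ = Σ₄-cong-mod λ p → *-cong-mod (a≡a′ p) (mod2^-refl (y p ^ 2))

form-congʳ-mod : ∀ {n} a {y y′} → (∀ p → y p ≡ y′ p mod2^ n) → form a y ≡ form a y′ mod2^ n
form-congʳ-mod a y≡y′ = Σ₄-cong-mod λ p → *-cong-mod (mod2^-refl (a p)) (^-cong-mod 2 (y≡y′ p))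

double-mod : ∀ {n} x → 2 * x ≡ 2 * (x %2^ n) mod2^ suc n
double-mod {n} x = mod2^-trans (≡⇒mod2^ (begin
  2 * x                                    ≡⟨ cong (2 *_) (m≡m%n+[m/n]*n x (2 ^ n)) ⟩
  2 * (x % 2 ^ n + x / 2 ^ n * 2 ^ n)      ≡⟨ double (x % 2 ^ n) (x / 2 ^ n) (2 ^ n) ⟩
  2 * (x % 2 ^ n) + x / 2 ^ n * 2 ^ suc n  ∎))
  (+-*2^-mod (2 * (x % 2 ^ n)) (x / 2 ^ n))
  where
  open ≡-Reasoning
  instance
    2ⁿ≢0 : NonZero (2 ^ n)
    2ⁿ≢0 = m^n≢0 2 n
  double : ∀ r k P → 2 * (r + k * P) ≡ 2 * r + k * (2 * P)
  double = solve-∀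

digit-mod : ∀ z m k → digit z (k + m) %2^ m ≡ digit z m
digit-mod z m zero = m<n⇒m%n≡m {{m^n≢0 2 m}} (bound z m)
digit-mod z m (suc k) with coh z (k + m)
... | inj₁ same = trans (cong (_%2^ m) same) (digit-mod z m k)
... | inj₂ next = trans (cong (_%2^ m) next)
    (trans (%-remove-+ʳ (digit z (k + m)) {{m^n≢0 2 m}} (divides (2 ^ k) (^-distribˡ-+-* 2 k m))) (digit-mod z m k))

%2^-suc : ∀ c n → c %2^ suc n ≡ c %2^ n ⊎ c %2^ suc n ≡ c %2^ n + 2 ^ n
%2^-suc c n with c / 2 ^ n % 2 | m%n<n (c / 2 ^ n) 2 | split
  where
  instance
    2ⁿ≢0 : NonZero (2 ^ n)
    2ⁿ≢0 = m^n≢0 2 n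
    2¹⁺ⁿ≢0 : NonZero (2 ^ suc n)
    2¹⁺ⁿ≢0 = m^n≢0 2 (suc n)
  split : c % 2 ^ suc n ≡ c % 2 ^ n + c / 2 ^ n % 2 * 2 ^ n
  split = trans (m≡m%n+[m/n]*n (c % 2 ^ suc n) (2 ^ n))
                (cong₂ (λ r q → r + q * 2 ^ n) (m∣n⇒o%n%m≡o%m (2 ^ n) (2 ^ suc n) c (n∣m*n 2)) (m%[n*o]/o≡m/o%n c 2 (2 ^ n)))
... | 0 | _ | low = inj₁ (trans low (+-identityʳ _))
... | 1 | _ | high = inj₂ (trans high (cong (c %2^ n +_) (+-identityʳ _)))
... | suc (suc _) | s≤s (s≤s ()) | _

const : ℕ → ℤ₂
const c = record { digit = c %2^_ ; bound = λ n → m%n<n c (2 ^ n) {{m^n≢0 2 n}} ; coh = %2^-suc c }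

integral : (Fin 4 → ℤ₂) → Fin 4 → ℚ₂
integral z p = z p /2^ 0

integral-QuadZero : ∀ {a} z → (∀ n → 2 ^ n ∣ form a (λ p → digit (z p) n)) → QuadZero a (integral z)
integral-QuadZero {a} z zero-mod-2ⁿ n =
  subst (2 ^ n ∣_) (Σ₄-cong λ p → cong (_* digit (z p) n ^ 2) (sym (*-identityʳ (a p)))) (zero-mod-2ⁿ n)

-- Hensel lifting of square roots

-- Adding 2^(2+m) to s changes u s² by u (2^(3+m) s + 2^(4+2m)) ≡ 2^(3+m) (mod 2^(4+m)), which is what
-- an odd quotient (u s² + N) / 2^(3+m) needs.
hensel-step : ∀ {u s N} m → Odd u → Odd s → 2 ^ (3 + m) ∣ u * s ^ 2 + N → ¬ 2 ^ (4 + m) ∣ u * s ^ 2 + N →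
              2 ^ (4 + m) ∣ u * (s + 2 ^ (2 + m)) ^ 2 + N
hensel-step {N = N} m (a , refl) (j , refl) (divides k fs≡k2³⁺ᵐ) 2⁴⁺ᵐ∤fs
  with %2≡1⇒Odd {k} (∤2⇒%2≡1 k-odd)
  where
  k-odd : ¬ 2 ∣ k
  k-odd (divides h refl) = 2⁴⁺ᵐ∤fs (divides h (trans fs≡k2³⁺ᵐ (reassociate h (2 ^ m))))
    where
    reassociate : ∀ h E → h * 2 * (2 * (2 * (2 * E))) ≡ h * (2 * (2 * (2 * (2 * E))))
    reassociate = solve-∀
... | k′ , refl = divides (1 + k′ + a + j + 2 * a * j + 2 ^ m * (1 + 2 * a)) (begin
  (1 + 2 * a) * (1 + 2 * j + 2 ^ (2 + m)) ^ 2 + N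
    ≡⟨ expand a j (2 ^ m) N ⟩
  ((1 + 2 * a) * (1 + 2 * j) ^ 2 + N) + (1 + 2 * a) * (2 ^ (3 + m) * (1 + 2 * j) + 2 ^ (2 + m) * 2 ^ (2 + m))
    ≡⟨ cong (_+ (1 + 2 * a) * (2 ^ (3 + m) * (1 + 2 * j) + 2 ^ (2 + m) * 2 ^ (2 + m))) fs≡k2³⁺ᵐ ⟩
  (1 + 2 * k′) * 2 ^ (3 + m) + (1 + 2 * a) * (2 ^ (3 + m) * (1 + 2 * j) + 2 ^ (2 + m) * 2 ^ (2 + m))
    ≡⟨ collect a j k′ (2 ^ m) ⟩
  (1 + k′ + a + j + 2 * a * j + 2 ^ m * (1 + 2 * a)) * 2 ^ (4 + m) ∎)
  where
  open ≡-Reasoning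
  expand : ∀ a j E N → (1 + 2 * a) * ((1 + 2 * j + 2 * (2 * E)) * ((1 + 2 * j + 2 * (2 * E)) * 1)) + N
         ≡ ((1 + 2 * a) * ((1 + 2 * j) * ((1 + 2 * j) * 1)) + N)
           + (1 + 2 * a) * (2 * (2 * (2 * E)) * (1 + 2 * j) + 2 * (2 * E) * (2 * (2 * E)))
  expand = solve-∀
  collect : ∀ a j k′ E → (1 + 2 * k′) * (2 * (2 * (2 * E)))
                          + (1 + 2 * a) * (2 * (2 * (2 * E)) * (1 + 2 * j) + 2 * (2 * E) * (2 * (2 * E)))
          ≡ (1 + k′ + a + j + 2 * a * j + E * (1 + 2 * a)) * (2 * (2 * (2 * (2 * E))))
  collect = solve-∀

module SquareRootLift {u N : ℕ} (u-odd : Odd u) (8∣u+N : 8 ∣ u + N) where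

  approx : ℕ → ℕ
  approx zero = 1
  approx (suc m) with 2 ^ (4 + m) ∣? u * approx m ^ 2 + N
  ... | yes _ = approx m
  ... | no _ = approx m + 2 ^ (2 + m)

  record Approximates (m s : ℕ) : Set where
    field
      bounded : s < 2 ^ (2 + m)
      odd : Odd s
      root-mod : 2 ^ (3 + m) ∣ u * s ^ 2 + N

  approx-approximates : ∀ m → Approximates m (approx m)
  approx-approximates zero = record
    { bounded = s≤s (s≤s z≤n) ; odd = 0 , refl ; root-mod = subst (8 ∣_) (cong (_+ N) (sym (*-identityʳ u))) 8∣u+N }
  approx-approximates (suc m) with approx-approximates m | 2 ^ (4 + m) ∣? u * approx m ^ 2 + N
  ... | A | yes root = record
    { bounded = <-≤-trans bounded (m≤m+n (2 ^ (2 + m)) _) ; odd = odd ; root-mod = root }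
    where open Approximates A
  ... | A | no ¬root = record
    { bounded = subst (approx m + 2 ^ (2 + m) <_) (cong (2 ^ (2 + m) +_) (sym (+-identityʳ _)))
                      (+-monoˡ-< (2 ^ (2 + m)) bounded)
    ; odd = odd-+-2^ odd
    ; root-mod = hensel-step m u-odd odd root-mod ¬root }
    where
    open Approximates A
    odd-+-2^ : ∀ {s} → Odd s → Odd (s + 2 ^ (2 + m))
    odd-+-2^ (j , refl) = j + 2 ^ (1 + m) , cong suc (regroup j (2 ^ m))
      where
      regroup : ∀ j E → 2 * j + 2 * (2 * E) ≡ 2 * (j + 2 * E)
      regroup = solve-∀

  digits : ℕ → ℕ
  digits zero = 0
  digits (suc zero) = 1
  digits (suc (suc m)) = approx m

  root : ℤ₂
  root = record { digit = digits ; bound = bounded ; coh = coherent }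
    where
    bounded : ∀ n → digits n < 2 ^ n
    bounded zero = s≤s z≤n
    bounded (suc zero) = s≤s (s≤s z≤n)
    bounded (suc (suc m)) = Approximates.bounded (approx-approximates m)
    coherent : ∀ n → digits (suc n) ≡ digits n ⊎ digits (suc n) ≡ digits n + 2 ^ n
    coherent zero = inj₂ refl
    coherent (suc zero) = inj₁ refl
    coherent (suc (suc m)) with 2 ^ (4 + m) ∣? u * approx m ^ 2 + N
    ... | yes _ = inj₁ refl
    ... | no _ = inj₂ refl

  root-nonZero : NonZero₂ root
  root-nonZero = 1 , λ ()

  root-isRoot : ∀ n → 2 ^ n ∣ u * digit root n ^ 2 + N
  root-isRoot zero = 1∣ _
  root-isRoot (suc zero) = ∣-trans (divides 4 refl) (Approximates.root-mod (approx-approximates 0))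
  root-isRoot (suc (suc m)) = ∣-trans (n∣m*n 2) (Approximates.root-mod (approx-approximates m))

sqrt-lift : ∀ e {u N} → u % 2 ≡ 1 → 2 ^ (3 + e) ∣ 2 ^ e * u + N →
            ∃ λ z → NonZero₂ z × ∀ n → 2 ^ n ∣ 2 ^ e * u * digit z n ^ 2 + N
sqrt-lift e {u} u-odd 2³⁺ᵉ∣ with ∣m+n∣m⇒∣n (∣-trans (2^-mono-∣ (m≤n+m e 3)) 2³⁺ᵉ∣) (m∣m*n u)
... | divides N′ refl = root , root-nonZero , λ n → subst (2 ^ n ∣_) (scale (2 ^ e) u (digit root n ^ 2) N′)
                                                   (∣n⇒∣m*n (2 ^ e) (root-isRoot n))
  where
  scale : ∀ E u D N′ → E * (u * D + N′) ≡ E * u * D + N′ * E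
  scale = solve-∀
  8∣u+N′ : 8 ∣ u + N′
  8∣u+N′ = *-cancelˡ-∣ (2 ^ e) {{m^n≢0 2 e}}
    (subst₂ _∣_ (trans (^-distribˡ-+-* 2 3 e) (*-comm 8 (2 ^ e))) (factor (2 ^ e) u N′) 2³⁺ᵉ∣)
    where
    factor : ∀ E u N′ → E * u + N′ * E ≡ E * (u + N′)
    factor = solve-∀
  open SquareRootLift {u} {N′} (%2≡1⇒Odd u-odd) 8∣u+N′

hasPoint-lift : ∀ e a u → a 0F ≡ 2 ^ e * u → u % 2 ≡ 1 → ∀ c₁ c₂ c₃ →
                2 ^ (3 + e) ∣ form a (tup 1 c₁ c₂ c₃) → HasQ₂Point a
hasPoint-lift e a u a₀≡2ᵉu u-odd c₁ c₂ c₃ 2³⁺ᵉ∣f[1,c] =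
  point (sqrt-lift e u-odd (subst (2 ^ (3 + e) ∣_) (trans (form-tup′ 1) (cong (_+ N) (*-identityʳ (2 ^ e * u))))
                                 2³⁺ᵉ∣f[1,c]))
  where
  N : ℕ
  N = a 1F * c₁ ^ 2 + a 2F * c₂ ^ 2 + a 3F * c₃ ^ 2
  form-tup′ : ∀ s → form a (tup s c₁ c₂ c₃) ≡ 2 ^ e * u * s ^ 2 + N
  form-tup′ s = trans (form-tup a s c₁ c₂ c₃) (cong (λ A → A * s ^ 2 + N) a₀≡2ᵉu)
  point : (∃ λ z → NonZero₂ z × ∀ n → 2 ^ n ∣ 2 ^ e * u * digit z n ^ 2 + N) → HasQ₂Point a
  point (z , z≢0 , z-root) = integral zs , (0F , z≢0) , integral-QuadZero {a} zs zs-root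
    where
    zs : Fin 4 → ℤ₂
    zs 0F = z
    zs 1F = const c₁
    zs 2F = const c₂
    zs 3F = const c₃
    digits-mod : ∀ n p → tup (digit z n) c₁ c₂ c₃ p ≡ digit (zs p) n mod2^ n
    digits-mod n 0F = mod2^-refl (digit z n)
    digits-mod n 1F = mod2^-sym (%2^-mod c₁)
    digits-mod n 2F = mod2^-sym (%2^-mod c₂)
    digits-mod n 3F = mod2^-sym (%2^-mod c₃)
    zs-root : ∀ n → 2 ^ n ∣ form a (λ p → digit (zs p) n)
    zs-root n = ∣-resp-mod (form-congʳ-mod a (digits-mod n)) (subst (2 ^ n ∣_) (sym (form-tup′ (digit z n))) (z-root n))

-- Descent

NoPrimitiveZeroMod16 : (Fin 4 → ℕ) → Set
NoPrimitiveZeroMod16 a = ∀ y → 16 ∣ form a y → ∀ p → 2 ∣ y p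

descent : ∀ {a} → NoPrimitiveZeroMod16 a → ∀ M y → 4 ^ M * 16 ∣ form a y → ∀ p → 2 ^ M ∣ y p
descent _ zero _ _ _ = 1∣ _
descent {a} no-zero (suc M) y 4¹⁺ᴹ16∣f[y] p =
  subst (2 ^ suc M ∣_) (2y′≡y p) (*-monoʳ-∣ 2 (descent {a} no-zero M y′ 4ᴹ16∣f[y′] p))
  where
  y′ : Fin 4 → ℕ
  y′ p = y p / 2
  2y′≡y : ∀ p → 2 * y′ p ≡ y p
  2y′≡y p = m*[n/m]≡n (no-zero y (∣-trans (n∣m*n (4 ^ suc M)) 4¹⁺ᴹ16∣f[y]) p)
  4ᴹ16∣f[y′] : 4 ^ M * 16 ∣ form a y′
  4ᴹ16∣f[y′] = *-cancelˡ-∣ 4 (subst₂ _∣_ (*-assoc 4 (4 ^ M) 16)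
                                        (trans (form-congʳ a (sym ∘ 2y′≡y)) (form-double a y′)) 4¹⁺ᴹ16∣f[y])

scale-square : ∀ A e d → A * 2 ^ (2 * e) * d ^ 2 ≡ A * (2 ^ e * d) ^ 2
scale-square A e d = begin
  A * 2 ^ (2 * e) * d ^ 2       ≡⟨ cong (λ t → A * t * d ^ 2) (trans (cong (2 ^_) (*-comm 2 e)) (sym (^-*-assoc 2 e 2))) ⟩
  A * (2 ^ e) ^ 2 * d ^ 2       ≡⟨ *-assoc A _ _ ⟩
  A * ((2 ^ e) ^ 2 * d ^ 2)     ≡⟨ cong (A *_) (square-* (2 ^ e) d) ⟨
  A * (2 ^ e * d) ^ 2           ∎
  where open ≡-Reasoning

-- The precision n has the shape k + n₀ required by digit-mod, with k large enough for the descent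
-- to make the scaled coordinate wᵢ = 2^(K - kᵢ) zᵢ divisible by 2^(K + n₀).
noQ₂Point : ∀ a → NoPrimitiveZeroMod16 a → ¬ HasQ₂Point a
noQ₂Point a no-zero (x , (i , n₀ , dᵢ≢0) , x-zero) = dᵢ≢0 dᵢ≡0
  where
  K : ℕ
  K = Σ₄ (den ∘ x)
  e : Fin 4 → ℕ
  e p = K ∸ den (x p)
  M : ℕ
  M = K + n₀
  n : ℕ
  n = (2 * M + 4) + n₀
  w : Fin 4 → ℕ
  w p = 2 ^ e p * digit (num (x p)) n
  2ⁿ∣f[w] : 2 ^ n ∣ form a w
  2ⁿ∣f[w] = subst (2 ^ n ∣_) (Σ₄-cong λ p → scale-square (a p) (e p) (digit (num (x p)) n)) (x-zero n)
  4ᴹ16∣2ⁿ : 4 ^ M * 16 ∣ 2 ^ n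
  4ᴹ16∣2ⁿ = divides (2 ^ n₀) (begin
    2 ^ n                          ≡⟨ ^-distribˡ-+-* 2 (2 * M + 4) n₀ ⟩
    2 ^ (2 * M + 4) * 2 ^ n₀       ≡⟨ cong (_* 2 ^ n₀) (^-distribˡ-+-* 2 (2 * M) 4) ⟩
    2 ^ (2 * M) * 16 * 2 ^ n₀      ≡⟨ cong (λ t → t * 16 * 2 ^ n₀) (^-*-assoc 2 2 M) ⟨
    4 ^ M * 16 * 2 ^ n₀            ≡⟨ *-comm (4 ^ M * 16) (2 ^ n₀) ⟩
    2 ^ n₀ * (4 ^ M * 16)          ∎)
    where open ≡-Reasoning
  2ᵉ2ⁿ⁰∣wᵢ : 2 ^ e i * 2 ^ n₀ ∣ 2 ^ e i * digit (num (x i)) n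
  2ᵉ2ⁿ⁰∣wᵢ = ∣-trans (subst (_∣ 2 ^ M) (^-distribˡ-+-* 2 (e i) n₀) (2^-mono-∣ (+-monoˡ-≤ n₀ (m∸n≤m K (den (x i))))))
                      (descent {a} no-zero M w (∣-trans 4ᴹ16∣2ⁿ 2ⁿ∣f[w]) i)
  dᵢ≡0 : digit (num (x i)) n₀ ≡ 0
  dᵢ≡0 = trans (sym (digit-mod (num (x i)) n₀ (2 * M + 4)))
               (n∣m⇒m%n≡0 _ (2 ^ n₀) {{m^n≢0 2 n₀}} (*-cancelˡ-∣ (2 ^ e i) {{m^n≢0 2 (e i)}} 2ᵉ2ⁿ⁰∣wᵢ))

-- Residues modulo 16 and the finite checks

residuePair : ℕ → ℕ → ℕ × ℕ
residuePair a y = a * y ^ 2 % 16 , y % 2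

-- For odd y, y² ≡ 1 (mod 8); for y = 2t, a y² = 4 a t² with t² ≡ 0 or 1 (mod 4).
oddCoefficientResidues : ℕ → List (ℕ × ℕ)
oddCoefficientResidues q = (q , 1) ∷ (q + 8 , 1) ∷ (0 , 0) ∷ (4 * (q % 4) , 0) ∷ []

evenCoefficientResidues : ℕ → List (ℕ × ℕ)
evenCoefficientResidues q = (2 * q , 1) ∷ (0 , 0) ∷ (8 , 0) ∷ []

square-mod16 : ∀ y → y ^ 2 ≡ (y % 8) ^ 2 mod2^ 4
square-mod16 y = mod2^-trans (≡⇒mod2^ (trans (cong (_^ 2) (m≡m%n+[m/n]*n y 8)) (expand (y % 8) (y / 8))))
                             (+-*2^-mod ((y % 8) ^ 2) (y % 8 * (y / 8) + 4 * (y / 8 * (y / 8))))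
  where
  expand : ∀ r t → (r + t * 8) * ((r + t * 8) * 1) ≡ r * (r * 1) + (r * t + 4 * (t * t)) * 16
  expand = solve-∀

residuePair-cong : ∀ {a a′} y → a ≡ a′ mod2^ 4 → residuePair a y ≡ residuePair a′ (y % 8)
residuePair-cong y a≡a′ = cong₂ _,_ (mod2^⇒%2^≡ (*-cong-mod a≡a′ (square-mod16 y)))
                                    (sym (m∣n⇒o%n%m≡o%m 2 8 y (divides 4 refl)))

OddBelow : ℕ → ℕ → Set
OddBelow m q = q < m × q % 2 ≡ 1

odd-residue : ∀ n x → x % 2 ≡ 1 → OddBelow (2 ^ suc n) (x %2^ suc n)
odd-residue n x x-odd = m%n<n x (2 ^ suc n) {{m^n≢0 2 (suc n)}}
                      , trans (m∣n⇒o%n%m≡o%m 2 (2 ^ suc n) x {{_}} {{m^n≢0 2 (suc n)}} (m∣m*n (2 ^ n))) x-odd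

AllOddBelow : ℕ → (ℕ → Set) → Set
AllOddBelow m P = ∀ {q} → OddBelow m q → P q

allOddBelow? : ∀ m {P : ℕ → Set} → (∀ q → Dec (P q)) → Dec (AllOddBelow m P)
allOddBelow? m P? = map′ (λ ∀P {q} (q<m , q-odd) → ∀P q<m q-odd) (λ ∀P {q} q<m q-odd → ∀P (q<m , q-odd))
                         (allUpTo? (λ q → (q % 2 ≟ 1) →-dec P? q) m)

-- The finite checks below are evaluated here once; opacity keeps them from being unfolded again.
opaque
  oddCoefficient-table : AllOddBelow 16 λ A → ∀ {R} → R < 8 → residuePair A R ∈ oddCoefficientResidues (A % 8)
  oddCoefficient-table = from-yes (allOddBelow? 16 λ A →
                           allUpTo? (λ R → residuePair A R ∈? oddCoefficientResidues (A % 8)) 8)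

  evenCoefficient-table : AllOddBelow 8 λ U → ∀ {R} → R < 8 → residuePair (2 * U) R ∈ evenCoefficientResidues U
  evenCoefficient-table = from-yes (allOddBelow? 8 λ U →
                            allUpTo? (λ R → residuePair (2 * U) R ∈? evenCoefficientResidues U) 8)

oddCoefficient-residuePair : ∀ a y → a % 2 ≡ 1 → residuePair a y ∈ oddCoefficientResidues (a % 8)
oddCoefficient-residuePair a y a-odd =
  subst₂ _∈_ (sym (residuePair-cong y (mod2^-sym (%2^-mod a))))
             (cong oddCoefficientResidues (m∣n⇒o%n%m≡o%m 8 16 a (divides 2 refl)))
         (oddCoefficient-table (odd-residue 3 a a-odd) (m%n<n y 8))

evenCoefficient-residuePair : ∀ u y → u % 2 ≡ 1 → residuePair (2 * u) y ∈ evenCoefficientResidues (u % 8)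
evenCoefficient-residuePair u y u-odd =
  subst (_∈ evenCoefficientResidues (u % 8)) (sym (residuePair-cong y (double-mod u)))
        (evenCoefficient-table (odd-residue 2 u u-odd) (m%n<n y 8))

EvenIfZero : (r₀ r₁ r₂ r₃ : ℕ × ℕ) → Set
EvenIfZero (v₀ , b₀) (v₁ , b₁) (v₂ , b₂) (v₃ , b₃) = (v₀ + v₁ + v₂ + v₃) % 16 ≡ 0 → b₀ ≡ 0 × b₁ ≡ 0 × b₂ ≡ 0 × b₃ ≡ 0

EvenResidueZeros : (Fin 4 → List (ℕ × ℕ)) → Set
EvenResidueZeros L = All (λ r₀ → All (λ r₁ → All (λ r₂ → All (EvenIfZero r₀ r₁ r₂) (L 3F)) (L 2F)) (L 1F)) (L 0F)

evenResidueZeros? : ∀ L → Dec (EvenResidueZeros L)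
evenResidueZeros? L =
  All.all? (λ r₀ → All.all? (λ r₁ → All.all? (λ r₂ → All.all? (evenIfZero? r₀ r₁ r₂) (L 3F)) (L 2F)) (L 1F)) (L 0F)
  where
  evenIfZero? : ∀ r₀ r₁ r₂ r₃ → Dec (EvenIfZero r₀ r₁ r₂ r₃)
  evenIfZero? (v₀ , b₀) (v₁ , b₁) (v₂ , b₂) (v₃ , b₃) =
    ((v₀ + v₁ + v₂ + v₃) % 16 ≟ 0) →-dec (b₀ ≟ 0 ×-dec b₁ ≟ 0 ×-dec b₂ ≟ 0 ×-dec b₃ ≟ 0)

residues⇒NoPrimitiveZero : ∀ a L → (∀ p y → residuePair (a p) y ∈ L p) → EvenResidueZeros L → NoPrimitiveZeroMod16 a
residues⇒NoPrimitiveZero a L a∈L even y 16∣f[y] p = m%n≡0⇒n∣m (y p) 2 (parity p)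
  where
  residue-sum≡0 : (a 0F * y 0F ^ 2 % 16 + a 1F * y 1F ^ 2 % 16 + a 2F * y 2F ^ 2 % 16 + a 3F * y 3F ^ 2 % 16) % 16 ≡ 0
  residue-sum≡0 = trans (mod2^⇒%2^≡ (Σ₄-cong-mod {4} λ p → %2^-mod (a p * y p ^ 2))) (n∣m⇒m%n≡0 _ 16 16∣f[y])
  parities : y 0F % 2 ≡ 0 × y 1F % 2 ≡ 0 × y 2F % 2 ≡ 0 × y 3F % 2 ≡ 0
  parities = All.lookup (All.lookup (All.lookup (All.lookup even (a∈L 0F (y 0F))) (a∈L 1F (y 1F)))
                                                (a∈L 2F (y 2F)))
                        (a∈L 3F (y 3F)) residue-sum≡0
  parity : ∀ p → y p % 2 ≡ 0
  parity 0F = proj₁ parities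
  parity 1F = proj₁ (proj₂ parities)
  parity 2F = proj₁ (proj₂ (proj₂ parities))
  parity 3F = proj₂ (proj₂ (proj₂ parities))

Unit₈? : ∀ q → Dec (Unit₈ q)
Unit₈? q = q <? 8 ×-dec q % 2 ≟ 1

units-resp : ∀ {q q′ : Fin 4 → ℕ} → (∀ i → q i ≡ q′ i) → (∀ i → Unit₈ (q i)) → ∀ i → Unit₈ (q′ i)
units-resp q≗q′ units i = subst Unit₈ (q≗q′ i) (units i)

𝒜₁? : ∀ q → Dec (𝒜₁ q)
𝒜₁? q = Fin.all? (Unit₈? ∘ q) ×-dec (Fin.any? (λ i → Fin.any? λ j →
          (i Fin.≟ 0F ⊎-dec i Fin.≟ 1F) ×-dec (j Fin.≟ 2F ⊎-dec j Fin.≟ 3F) ×-dec (q i ⊕ q j ≟ 0 ⊎-dec q i ⊕ q j ≟ 4))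
        ⊎-dec ((q 0F ⊕ q 1F , q 2F ⊕ q 3F) ∈? A₁pairs))

𝒜₁-resp : ∀ {q q′} → (∀ i → q i ≡ q′ i) → 𝒜₁ q → 𝒜₁ q′
𝒜₁-resp q≗q′ (units , inj₁ (i , j , i∈01 , j∈23 , s)) =
  units-resp q≗q′ units , inj₁ (i , j , i∈01 , j∈23 , subst₂ (λ x y → x ⊕ y ≡ 0 ⊎ x ⊕ y ≡ 4) (q≗q′ i) (q≗q′ j) s)
𝒜₁-resp q≗q′ (units , inj₂ sums) =
  units-resp q≗q′ units ,
  inj₂ (subst (_∈ A₁pairs) (cong₂ _,_ (cong₂ _⊕_ (q≗q′ 0F) (q≗q′ 1F)) (cong₂ _⊕_ (q≗q′ 2F) (q≗q′ 3F))) sums)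

PairCondition : ℕ → ℕ → ℕ → ℕ → ℕ → Set
PairCondition x y z w v = (x ⊕ y ≡ 0 × (z + v) * (w + v) % 8 ≡ 0) ⊎ (x ⊕ y ≡ 2 * v % 8 × (z + v) * (w + v) % 8 ≡ 0)

UnitWitness : (ℕ → Set) → Set
UnitWitness P = Σ ℕ λ v → Unit₈ v × P v

𝒜₂-split : ∀ {q} → 𝒜₂ q ⇔ ((∀ i → Unit₈ (q i)) × (UnitWitness (PairCondition (q 0F) (q 1F) (q 2F) (q 3F))
                                                 ⊎ UnitWitness (PairCondition (q 2F) (q 3F) (q 0F) (q 1F))))
𝒜₂-split = mk⇔ (λ { (units , _ , _ , _ , _ , inj₁ ((refl , refl) , (refl , refl)) , witness) → units , inj₁ witness
                  ; (units , _ , _ , _ , _ , inj₂ ((refl , refl) , (refl , refl)) , witness) → units , inj₂ witness })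
               (λ { (units , inj₁ witness) → units , 0F , 1F , 2F , 3F , inj₁ ((refl , refl) , (refl , refl)) , witness
                  ; (units , inj₂ witness) → units , 2F , 3F , 0F , 1F , inj₂ ((refl , refl) , (refl , refl)) , witness })

𝒜₂? : ∀ q → Dec (𝒜₂ q)
𝒜₂? q = map′ from to (Fin.all? (Unit₈? ∘ q) ×-dec (unitWitness? (pairCondition? (q 0F) (q 1F) (q 2F) (q 3F))
                                                  ⊎-dec unitWitness? (pairCondition? (q 2F) (q 3F) (q 0F) (q 1F))))
  where
  open Equivalence 𝒜₂-split
  pairCondition? : ∀ x y z w v → Dec (PairCondition x y z w v)
  pairCondition? x y z w v =
    (x ⊕ y ≟ 0 ×-dec (z + v) * (w + v) % 8 ≟ 0) ⊎-dec (x ⊕ y ≟ 2 * v % 8 ×-dec (z + v) * (w + v) % 8 ≟ 0)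
  unitWitness? : {P : ℕ → Set} → (∀ v → Dec (P v)) → Dec (UnitWitness P)
  unitWitness? P? = map′ (λ (v , _ , unit , Pv) → v , unit , Pv) (λ (v , unit , Pv) → v , proj₁ unit , unit , Pv)
                         (anyUpTo? (λ v → Unit₈? v ×-dec P? v) 8)

𝒜₂-resp : ∀ {q q′} → (∀ i → q i ≡ q′ i) → 𝒜₂ q → 𝒜₂ q′
𝒜₂-resp {q} {q′} q≗q′ A with Equivalence.to 𝒜₂-split A
... | units , witness = Equivalence.from 𝒜₂-split
        (units-resp q≗q′ units ,
         Sum.map (transport (q≗q′ 0F) (q≗q′ 1F) (q≗q′ 2F) (q≗q′ 3F)) (transport (q≗q′ 2F) (q≗q′ 3F) (q≗q′ 0F) (q≗q′ 1F))
                 witness)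
  where
  transport : ∀ {x y z w x′ y′ z′ w′} → x ≡ x′ → y ≡ y′ → z ≡ z′ → w ≡ w′ →
              UnitWitness (PairCondition x y z w) → UnitWitness (PairCondition x′ y′ z′ w′)
  transport refl refl refl refl witness = witness

-- The bound 4 on the cᵢ only makes ZeroMod decidable; the checks find witnesses below it.
ZeroMod : ℕ → (Fin 4 → ℕ) → Set
ZeroMod m q = ∃ λ c₁ → c₁ < 4 × ∃ λ c₂ → c₂ < 4 × ∃ λ c₃ → c₃ < 4 × m ∣ form q (tup 1 c₁ c₂ c₃)

zeroMod? : ∀ m q → Dec (ZeroMod m q)
zeroMod? m q = anyUpTo? (λ c₁ → anyUpTo? (λ c₂ → anyUpTo? (λ c₃ → m ∣? form q (tup 1 c₁ c₂ c₃)) 4) 4) 4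

mixedResidues : ℕ → ℕ → ℕ → ℕ → Fin 4 → List (ℕ × ℕ)
mixedResidues u₀ u₁ q₂ q₃ 0F = evenCoefficientResidues u₀
mixedResidues u₀ u₁ q₂ q₃ 1F = evenCoefficientResidues u₁
mixedResidues u₀ u₁ q₂ q₃ 2F = oddCoefficientResidues q₂
mixedResidues u₀ u₁ q₂ q₃ 3F = oddCoefficientResidues q₃

opaque
  oddForm-dichotomy : AllOddBelow 8 λ q₀ → AllOddBelow 8 λ q₁ → AllOddBelow 8 λ q₂ → AllOddBelow 8 λ q₃ →
                      𝒜₁ (tup q₀ q₁ q₂ q₃) ⊎ EvenResidueZeros (oddCoefficientResidues ∘ tup q₀ q₁ q₂ q₃)
  oddForm-dichotomy = from-yes (allOddBelow? 8 λ q₀ → allOddBelow? 8 λ q₁ → allOddBelow? 8 λ q₂ → allOddBelow? 8 λ q₃ →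
                        𝒜₁? (tup q₀ q₁ q₂ q₃) ⊎-dec evenResidueZeros? (oddCoefficientResidues ∘ tup q₀ q₁ q₂ q₃))

  oddForm-zero : AllOddBelow 8 λ q₀ → AllOddBelow 8 λ q₁ → AllOddBelow 8 λ q₂ → AllOddBelow 8 λ q₃ →
                 𝒜₁ (tup q₀ q₁ q₂ q₃) → ZeroMod 8 (tup q₀ q₁ q₂ q₃)
  oddForm-zero = from-yes (allOddBelow? 8 λ q₀ → allOddBelow? 8 λ q₁ → allOddBelow? 8 λ q₂ → allOddBelow? 8 λ q₃ →
                   𝒜₁? (tup q₀ q₁ q₂ q₃) →-dec zeroMod? 8 (tup q₀ q₁ q₂ q₃))

  mixedForm-dichotomy : AllOddBelow 8 λ u₀ → AllOddBelow 8 λ u₁ → AllOddBelow 8 λ q₂ → AllOddBelow 8 λ q₃ →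
                        𝒜₂ (tup u₀ u₁ q₂ q₃) ⊎ EvenResidueZeros (mixedResidues u₀ u₁ q₂ q₃)
  mixedForm-dichotomy = from-yes (allOddBelow? 8 λ u₀ → allOddBelow? 8 λ u₁ → allOddBelow? 8 λ q₂ → allOddBelow? 8 λ q₃ →
                          𝒜₂? (tup u₀ u₁ q₂ q₃) ⊎-dec evenResidueZeros? (mixedResidues u₀ u₁ q₂ q₃))

  mixedForm-zero : AllOddBelow 8 λ u₀ → AllOddBelow 8 λ u₁ → AllOddBelow 16 λ r₂ → AllOddBelow 16 λ r₃ →
                   𝒜₂ (tup u₀ u₁ (r₂ % 8) (r₃ % 8)) →
                   ZeroMod 16 (tup (2 * u₀) (2 * u₁) r₂ r₃) ⊎ ZeroMod 8 (tup r₂ r₃ (2 * u₀) (2 * u₁))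
  mixedForm-zero = from-yes (allOddBelow? 8 λ u₀ → allOddBelow? 8 λ u₁ → allOddBelow? 16 λ r₂ → allOddBelow? 16 λ r₃ →
                     𝒜₂? (tup u₀ u₁ (r₂ % 8) (r₃ % 8)) →-dec
                     (zeroMod? 16 (tup (2 * u₀) (2 * u₁) r₂ r₃) ⊎-dec zeroMod? 8 (tup r₂ r₃ (2 * u₀) (2 * u₁))))

-- Permuting the coordinates

select : Fin 4 → Fin 4 → Fin 4 → Fin 4 → Fin 4 → Fin 4
select i j k l 0F = i
select i j k l 1F = j
select i j k l 2F = k
select i j k l 3F = l

position : Fin 4 → Fin 4 → Fin 4 → Fin 4 → Fin 4 → Fin 4
position i j k l p = if does (p Fin.≟ i) then 0F else if does (p Fin.≟ j) then 1F else if does (p Fin.≟ k) then 2F else 3F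

select-position : ∀ i j k l → i ≢ j → i ≢ k → i ≢ l → j ≢ k → j ≢ l → k ≢ l → ∀ p → select i j k l (position i j k l p) ≡ p
select-position = from-yes (Fin.all? λ i → Fin.all? λ j → Fin.all? λ k → Fin.all? λ l →
  ¬? (i Fin.≟ j) →-dec ¬? (i Fin.≟ k) →-dec ¬? (i Fin.≟ l) →-dec ¬? (j Fin.≟ k) →-dec ¬? (j Fin.≟ l) →-dec ¬? (k Fin.≟ l) →-dec
  Fin.all? λ p → select i j k l (position i j k l p) Fin.≟ p)

position-select : ∀ i j k l → i ≢ j → i ≢ k → i ≢ l → j ≢ k → j ≢ l → k ≢ l → ∀ p → position i j k l (select i j k l p) ≡ p
position-select = from-yes (Fin.all? λ i → Fin.all? λ j → Fin.all? λ k → Fin.all? λ l →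
  ¬? (i Fin.≟ j) →-dec ¬? (i Fin.≟ k) →-dec ¬? (i Fin.≟ l) →-dec ¬? (j Fin.≟ k) →-dec ¬? (j Fin.≟ l) →-dec ¬? (k Fin.≟ l) →-dec
  Fin.all? λ p → position i j k l (select i j k l p) Fin.≟ p)

selection : ∀ {i j k l} → i ≢ j → i ≢ k → i ≢ l → j ≢ k → j ≢ l → k ≢ l → Permutation′ 4
selection {i} {j} {k} {l} i≢j i≢k i≢l j≢k j≢l k≢l = permutation (select i j k l) (position i j k l)
  (select-position i j k l i≢j i≢k i≢l j≢k j≢l k≢l) (position-select i j k l i≢j i≢k i≢l j≢k j≢l k≢l)

Σ₄-permute : ∀ (π : Permutation′ 4) f → Σ₄ (f ∘ (π ⟨$⟩ʳ_)) ≡ Σ₄ f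
Σ₄-permute π f = trans (Σ₄≡sum (f ∘ (π ⟨$⟩ʳ_))) (trans (sym (sum-permute f π)) (sym (Σ₄≡sum f)))
  where
  Σ₄≡sum : ∀ g → Σ₄ g ≡ sum g
  Σ₄≡sum g = reassociate (g 0F) (g 1F) (g 2F) (g 3F)
    where
    reassociate : ∀ a b c d → a + b + c + d ≡ a + (b + (c + (d + 0)))
    reassociate = solve-∀

HasQ₂Point-permute : ∀ {a} (π : Permutation′ 4) → HasQ₂Point a → HasQ₂Point (a ∘ (π ⟨$⟩ʳ_))
HasQ₂Point-permute {a} π (x , (p , xₚ≢0) , x-zero) =
  x ∘ (π ⟨$⟩ʳ_) , (π ⟨$⟩ˡ p , subst (NonZeroℚ₂ ∘ x) (sym (inverseʳ π)) xₚ≢0) , permuted-zero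
  where
  term : ℕ → ℕ → Fin 4 → ℕ
  term n K p = a p * 2 ^ (2 * (K ∸ den (x p))) * digit (num (x p)) n ^ 2
  permuted-zero : QuadZero (a ∘ (π ⟨$⟩ʳ_)) (x ∘ (π ⟨$⟩ʳ_))
  permuted-zero n = subst (2 ^ n ∣_)
    (sym (trans (cong (λ K → Σ₄ (term n K ∘ (π ⟨$⟩ʳ_))) (Σ₄-permute π (den ∘ x))) (Σ₄-permute π (term n (Σ₄ (den ∘ x))))))
    (x-zero n)

HasQ₂Point-resp : ∀ {a b} → (∀ p → a p ≡ b p) → HasQ₂Point a → HasQ₂Point b
HasQ₂Point-resp a≗b (x , x≢0 , x-zero) = x , x≢0 , λ n → subst (2 ^ n ∣_) (Σ₄-cong λ p → cong (term n p) (a≗b p)) (x-zero n)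
  where
  term : ℕ → Fin 4 → ℕ → ℕ
  term n p A = A * 2 ^ (2 * (Σ₄ (den ∘ x) ∸ den (x p))) * digit (num (x p)) n ^ 2

HasQ₂Point-permute⇔ : ∀ {a} (π : Permutation′ 4) → HasQ₂Point a ⇔ HasQ₂Point (a ∘ (π ⟨$⟩ʳ_))
HasQ₂Point-permute⇔ {a} π = mk⇔ (HasQ₂Point-permute {a} π)
  (HasQ₂Point-resp {a ∘ (π ⟨$⟩ʳ_) ∘ (π ⟨$⟩ˡ_)} {a} (λ p → cong a (inverseʳ π {p}))
   ∘ HasQ₂Point-permute {a ∘ (π ⟨$⟩ʳ_)} (flip π))

module OddForm (a : Fin 4 → ℕ) (a-odd : ∀ p → a p % 2 ≡ 1) where

  residues₈ : Fin 4 → ℕ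
  residues₈ = tup (a 0F % 8) (a 1F % 8) (a 2F % 8) (a 3F % 8)

  unit : ∀ p → OddBelow 8 (a p % 8)
  unit p = odd-residue 2 (a p) (a-odd p)

  residues : ∀ p y → residuePair (a p) y ∈ oddCoefficientResidues (residues₈ p)
  residues p y = subst (residuePair (a p) y ∈_) (cong oddCoefficientResidues (sym (tup-η (red₈ a) p)))
                       (oddCoefficient-residuePair (a p) y (a-odd p))

  coefficients-mod8 : ∀ p → residues₈ p ≡ a p mod2^ 3
  coefficients-mod8 p = subst (_≡ a p mod2^ 3) (sym (tup-η (red₈ a) p)) (%2^-mod (a p))

  necessary : HasQ₂Point a → 𝒜₁ (red₈ a)
  necessary point with oddForm-dichotomy (unit 0F) (unit 1F) (unit 2F) (unit 3F)
  ... | inj₁ A = 𝒜₁-resp (tup-η (red₈ a)) A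
  ... | inj₂ even = ⊥-elim (noQ₂Point a (residues⇒NoPrimitiveZero a (oddCoefficientResidues ∘ residues₈) residues even) point)

  sufficient : 𝒜₁ (red₈ a) → HasQ₂Point a
  sufficient A with oddForm-zero (unit 0F) (unit 1F) (unit 2F) (unit 3F) (𝒜₁-resp (sym ∘ tup-η (red₈ a)) A)
  ... | c₁ , _ , c₂ , _ , c₃ , _ , 8∣f[1,c] = hasPoint-lift 0 a (a 0F) (sym (*-identityˡ (a 0F))) (a-odd 0F) c₁ c₂ c₃
                                                (∣-resp-mod (form-congˡ-mod (tup 1 c₁ c₂ c₃) coefficients-mod8) 8∣f[1,c])

  criterion : HasQ₂Point a ⇔ 𝒜₁ (red₈ a)
  criterion = mk⇔ necessary sufficient

pairSwap : Permutation′ 4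
pairSwap = selection {2F} {3F} {0F} {1F} (λ ()) (λ ()) (λ ()) (λ ()) (λ ()) (λ ())

module MixedForm (b : Fin 4 → ℕ) (u₀ u₁ : ℕ) (b₀≡2u₀ : b 0F ≡ 2 * u₀) (b₁≡2u₁ : b 1F ≡ 2 * u₁)
                 (u₀-odd : u₀ % 2 ≡ 1) (u₁-odd : u₁ % 2 ≡ 1) (b₂-odd : b 2F % 2 ≡ 1) (b₃-odd : b 3F % 2 ≡ 1) where

  q : Fin 4 → ℕ
  q = red₈ (tup u₀ u₁ (b 2F) (b 3F))

  L : Fin 4 → List (ℕ × ℕ)
  L = mixedResidues (u₀ % 8) (u₁ % 8) (b 2F % 8) (b 3F % 8)

  residues : ∀ p y → residuePair (b p) y ∈ L p
  residues 0F y = subst (λ B → residuePair B y ∈ L 0F) (sym b₀≡2u₀) (evenCoefficient-residuePair u₀ y u₀-odd)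
  residues 1F y = subst (λ B → residuePair B y ∈ L 1F) (sym b₁≡2u₁) (evenCoefficient-residuePair u₁ y u₁-odd)
  residues 2F y = oddCoefficient-residuePair (b 2F) y b₂-odd
  residues 3F y = oddCoefficient-residuePair (b 3F) y b₃-odd

  coefficients-mod16 : ∀ p → tup (2 * (u₀ % 8)) (2 * (u₁ % 8)) (b 2F % 16) (b 3F % 16) p ≡ b p mod2^ 4
  coefficients-mod16 0F = mod2^-trans (mod2^-sym (double-mod u₀)) (≡⇒mod2^ (sym b₀≡2u₀))
  coefficients-mod16 1F = mod2^-trans (mod2^-sym (double-mod u₁)) (≡⇒mod2^ (sym b₁≡2u₁))
  coefficients-mod16 2F = %2^-mod (b 2F)
  coefficients-mod16 3F = %2^-mod (b 3F)

  swapped-mod8 : ∀ p → tup (b 2F % 16) (b 3F % 16) (2 * (u₀ % 8)) (2 * (u₁ % 8)) p ≡ b (pairSwap ⟨$⟩ʳ p) mod2^ 3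
  swapped-mod8 0F = mod2^-weaken (n≤1+n 3) (coefficients-mod16 2F)
  swapped-mod8 1F = mod2^-weaken (n≤1+n 3) (coefficients-mod16 3F)
  swapped-mod8 2F = mod2^-weaken (n≤1+n 3) (coefficients-mod16 0F)
  swapped-mod8 3F = mod2^-weaken (n≤1+n 3) (coefficients-mod16 1F)

  q-via-mod16 : ∀ p → q p ≡ tup (u₀ % 8) (u₁ % 8) (b 2F % 16 % 8) (b 3F % 16 % 8) p
  q-via-mod16 0F = refl
  q-via-mod16 1F = refl
  q-via-mod16 2F = sym (m∣n⇒o%n%m≡o%m 8 16 (b 2F) (divides 2 refl))
  q-via-mod16 3F = sym (m∣n⇒o%n%m≡o%m 8 16 (b 3F) (divides 2 refl))

  necessary : HasQ₂Point b → 𝒜₂ q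
  necessary point with mixedForm-dichotomy (odd-residue 2 u₀ u₀-odd) (odd-residue 2 u₁ u₁-odd)
                                           (odd-residue 2 (b 2F) b₂-odd) (odd-residue 2 (b 3F) b₃-odd)
  ... | inj₁ A = 𝒜₂-resp (tup-η q) A
  ... | inj₂ even = ⊥-elim (noQ₂Point b (residues⇒NoPrimitiveZero b L residues even) point)

  sufficient : 𝒜₂ q → HasQ₂Point b
  sufficient A with mixedForm-zero (odd-residue 2 u₀ u₀-odd) (odd-residue 2 u₁ u₁-odd)
                                   (odd-residue 3 (b 2F) b₂-odd) (odd-residue 3 (b 3F) b₃-odd) (𝒜₂-resp q-via-mod16 A)
  ... | inj₁ (c₁ , _ , c₂ , _ , c₃ , _ , 16∣f[1,c]) =
    hasPoint-lift 1 b u₀ b₀≡2u₀ u₀-odd c₁ c₂ c₃ (∣-resp-mod (form-congˡ-mod (tup 1 c₁ c₂ c₃) coefficients-mod16) 16∣f[1,c])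
  ... | inj₂ (c₁ , _ , c₂ , _ , c₃ , _ , 8∣f[1,c]) = Equivalence.from (HasQ₂Point-permute⇔ {b} pairSwap)
    (hasPoint-lift 0 (b ∘ (pairSwap ⟨$⟩ʳ_)) (b 2F) (sym (*-identityˡ (b 2F))) b₂-odd c₁ c₂ c₃
                   (∣-resp-mod (form-congˡ-mod (tup 1 c₁ c₂ c₃) swapped-mod8) 8∣f[1,c]))

  criterion : HasQ₂Point b ⇔ 𝒜₂ q
  criterion = mk⇔ necessary sufficient

lemma4p4 : (a : Fin 4 → ℕ) → (∀ i → SquareFree (a i)) → (∀ i → a i ≢ 0) →
    gcd (gcd (a 0F) (a 1F)) (gcd (a 2F) (a 3F)) ≡ 1 →
    ((¬ 2 ∣ a 0F * a 1F * a 2F * a 3F) → (HasQ₂Point a ⇔ 𝒜₁ (red₈ a)))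
    × ((i j k l : Fin 4) → i ≢ j → i ≢ k → i ≢ l → j ≢ k → j ≢ l → k ≢ l →
       2 ∣ a i → 2 ∣ a j → ¬ 2 ∣ a k * a l →
       (HasQ₂Point a ⇔ 𝒜₂ (red₈ (tup (a i / 2) (a j / 2) (a k) (a l)))))
lemma4p4 a square-free _ _ = odd-case , mixed-case
  where
  odd-case : ¬ 2 ∣ a 0F * a 1F * a 2F * a 3F → HasQ₂Point a ⇔ 𝒜₁ (red₈ a)
  odd-case 2∤a₀a₁a₂a₃ = OddForm.criterion a (odd-coefficients a 2∤a₀a₁a₂a₃)
  mixed-case : (i j k l : Fin 4) → i ≢ j → i ≢ k → i ≢ l → j ≢ k → j ≢ l → k ≢ l → 2 ∣ a i → 2 ∣ a j → ¬ 2 ∣ a k * a l →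
               HasQ₂Point a ⇔ 𝒜₂ (red₈ (tup (a i / 2) (a j / 2) (a k) (a l)))
  mixed-case i j k l i≢j i≢k i≢l j≢k j≢l k≢l 2∣aᵢ 2∣aⱼ 2∤aₖaₗ =
    ⇔-trans (HasQ₂Point-permute⇔ {a} π)
            (MixedForm.criterion (a ∘ (π ⟨$⟩ʳ_)) (a i / 2) (a j / 2)
                                 (sym (m*[n/m]≡n 2∣aᵢ)) (sym (m*[n/m]≡n 2∣aⱼ))
                                 (half-odd (a i) (square-free i) 2∣aᵢ) (half-odd (a j) (square-free j) 2∣aⱼ)
                                 (∤2⇒%2≡1 (∤-*ˡ (a k) (a l) 2∤aₖaₗ)) (∤2⇒%2≡1 (∤-*ʳ (a k) (a l) 2∤aₖaₗ)))
    where
    π : Permutation′ 4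
    π = selection i≢j i≢k i≢l j≢k j≢l k≢l
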